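{- Let $G$ be an oriented graph on $n$ vertices in which every vertex has in-degree and out-degree at least $3n/8$. Then for every two vertices $x,y$ of $G$ there is a directed path from $x$ to $y$ of length at most $4$; that is, the directed diameter of $G$ is at most $4$.
   Context: An oriented graph is a digraph obtained by orienting the edges of a simple graph (at most one of $xy$, $yx$ for each pair of vertices). -}

module Defs where

open import Data.Nat using (ℕ; suc; _≤_)
open import Data.Fin using (Fin)
open import Data.Bool using (Bool; true; false; T)
open import Data.List using (List; []; _∷_; length; filter; head; last)
open import Data.List.Relation.Unary.Unique.Propositional using (Unique)
open import Data.Fin.Properties using (_≟_)
open import Data.Vec.Functional using (Vector)
open import Data.List using (allFin)
open import Data.Maybe using (Maybe; just)
open import Data.Product using (_×_; Σ; _,_)
open import Relation.Nullary using (¬_)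
open import Relation.Binary.PropositionalEquality using (_≡_)
open import Relation.Nullary.Decidable using (does)
open import Data.Bool.Properties using (T?)

-- A digraph on vertex set Fin n, given by its (decidable) arc relation:
-- E x y ≡ true  iff  there is an arc x → y.
Digraph : ℕ → Set
Digraph n = Fin n → Fin n → Bool

record IsOriented {n : ℕ} (E : Digraph n) : Set where
  field
    irrefl : ∀ x → ¬ T (E x x)
    asym   : ∀ x y → T (E x y) → ¬ T (E y x)

outdeg : ∀ {n} → Digraph n → Fin n → ℕ
outdeg {n} E x = length (filter (λ y → T? (E x y)) (allFin n))

indeg : ∀ {n} → Digraph n → Fin n → ℕ
indeg {n} E x = length (filter (λ y → T? (E y x)) (allFin n))

data Chain {n : ℕ} (E : Digraph n) : List (Fin n) → Set where
  []  : Chain E []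
  [_] : ∀ v → Chain E (v ∷ [])
  _∷_ : ∀ {u v vs} → T (E u v) → Chain E (v ∷ vs) → Chain E (u ∷ v ∷ vs)

record DirPath {n : ℕ} (E : Digraph n) (x y : Fin n) : Set where
  constructor path
  field
    verts    : List (Fin n)
    chain    : Chain E verts
    distinct : Unique verts
    starts   : head verts ≡ just x
    ends     : last verts ≡ just y

pathLength : ∀ {n} {E : Digraph n} {x y} → DirPath E x y → ℕ
pathLength p = Data.Nat.pred (length (DirPath.verts p))
  where import Data.Nat

module Submission where

-- Write N²(x) for the set of vertices reachable from x by a walk of length
-- 1 or 2.  Double counting the arcs shows that in an oriented graph every
-- vertex set P with |P| ≥ 1 contains a vertex a with fewer than |P|/2
-- out-neighbours inside P.  Taking P = N⁺(x), the sets N⁺(x) and N⁺(a) both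
-- lie in N²(x) and overlap in fewer than |N⁺(x)|/2 vertices, so
--   |N²(x)| > |N⁺(x)|/2 + |N⁺(a)| ≥ 3n/16 + 3n/8 = 9n/16.
-- Applied to the reversed graph, the same bound holds for the set of
-- vertices from which y is reached in 1 or 2 steps.  Two sets of more than
-- n/2 vertices meet, giving a walk from x to y of length at most 4, and
-- erasing loops turns it into a path.

open import Defs
open import Data.Nat using (ℕ; zero; suc; _+_; _*_; _≤_; _<_; z≤n; s≤s; _<?_)
open import Data.Nat.Properties hiding (_≟_)
open import Data.Nat.Tactic.RingSolver using (solve-∀)
open import Data.Bool using (Bool; true; false; T; _∧_; _∨_)
open import Data.Bool.Properties using (T?; T-∨; T-∧)
open import Data.Fin using (Fin; zero; suc)
open import Data.Fin.Properties using (_≟_; any?)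
open import Data.List using (List; []; _∷_; length; filter; tabulate; last)
open import Data.Maybe using (just)
open import Data.List.Membership.Propositional using (_∈_)
open import Data.List.Relation.Unary.Any using (here; there)
import Data.List.Relation.Unary.Any as Any
open import Data.List.Relation.Unary.All using ([])
open import Data.List.Relation.Unary.All.Properties using (¬Any⇒All¬)
open import Data.List.Relation.Unary.AllPairs using ([]; _∷_)
open import Data.List.Relation.Unary.Unique.Propositional using (Unique)
open import Data.Product using (Σ; _×_; _,_; ∃-syntax; map₂)
open import Data.Sum using (_⊎_; inj₁; inj₂)
open import Data.Empty using (⊥-elim)
open import Data.Unit using (tt)
open import Function using (_∘_; flip; id; Equivalence)
open import Relation.Nullary using (¬_; Dec; yes; no; _×-dec_; contradiction)
open import Relation.Nullary.Decidable using (⌊_⌋; toWitness; fromWitness)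
open import Relation.Binary.PropositionalEquality
open import Algebra.Properties.Semiring.Sum +-*-semiring
  using (sum; sum-syntax; ∑-distrib-+; ∑-comm; *-distribˡ-sum; sum-cong-≗; sum-remove)
open Equivalence using (to; from)

ind : Bool → ℕ
ind true  = 1
ind false = 0

size : ∀ {n} → (Fin n → Bool) → ℕ
size {n} P = ∑[ v < n ] ind (P v)

sum-mono : ∀ {n} {f g : Fin n → ℕ} → (∀ i → f i ≤ g i) → sum f ≤ sum g
sum-mono {zero}  f≤g = z≤n
sum-mono {suc n} f≤g = +-mono-≤ (f≤g zero) (sum-mono (f≤g ∘ suc))

summand≤sum : ∀ {n} (f : Fin n → ℕ) i → f i ≤ sum f
summand≤sum {suc n} f i = ≤-trans (m≤m+n (f i) _) (≤-reflexive (sym (sum-remove {i = i} f)))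

length-filter-tabulate : ∀ {A : Set} {n} (P : A → Bool) (f : Fin n → A) →
  length (filter (λ a → T? (P a)) (tabulate f)) ≡ ∑[ i < n ] ind (P (f i))
length-filter-tabulate {n = zero}  P f = refl
length-filter-tabulate {n = suc n} P f with P (f zero)
... | true  = cong suc (length-filter-tabulate P (f ∘ suc))
... | false = length-filter-tabulate P (f ∘ suc)

outdeg≡size : ∀ {n} (E : Digraph n) x → outdeg E x ≡ size (E x)
outdeg≡size E x = length-filter-tabulate (E x) id

size-all : ∀ n → size {n} (λ _ → true) ≡ n
size-all zero    = refl
size-all (suc n) = cong suc (size-all n)

size-witness : ∀ {n} (P : Fin n → Bool) → 1 ≤ size P → ∃[ v ] T (P v)
size-witness {suc n} P pos with P zero in P0
... | true  = zero , subst T (sym P0) tt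
... | false with size-witness (P ∘ suc) pos
...   | v , Pv = suc v , Pv

size-union : ∀ {n} (P Q R : Fin n → Bool) → (∀ v → T (P v) ⊎ T (Q v) → T (R v)) →
  size P + size Q ≤ size R + size (λ v → P v ∧ Q v)
size-union {n} P Q R P∪Q⊆R = begin
  size P + size Q                                   ≡⟨ ∑-distrib-+ (ind ∘ P) (ind ∘ Q) ⟨
  ∑[ v < n ] (ind (P v) + ind (Q v))                ≤⟨ sum-mono (λ v → pointwise (P v) (Q v) (R v) (P∪Q⊆R v)) ⟩
  ∑[ v < n ] (ind (R v) + ind (P v ∧ Q v))          ≡⟨ ∑-distrib-+ (ind ∘ R) (λ v → ind (P v ∧ Q v)) ⟩
  size R + size (λ v → P v ∧ Q v)                   ∎
  where
  open ≤-Reasoning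
  pointwise : ∀ p q r → (T p ⊎ T q → T r) → ind p + ind q ≤ ind r + ind (p ∧ q)
  pointwise true  true  true  _ = ≤-refl
  pointwise true  false true  _ = ≤-refl
  pointwise false true  true  _ = ≤-refl
  pointwise false false true  _ = z≤n
  pointwise true  _     false h = ⊥-elim (h (inj₁ tt))
  pointwise false true  false h = ⊥-elim (h (inj₂ tt))
  pointwise false false false _ = z≤n

module InducedSubgraph {n} (E : Digraph n) (ori : IsOriented E) (P : Fin n → Bool) where
  open IsOriented ori

  d : ℕ
  d = size P

  outIn inIn : Fin n → ℕ
  outIn a = size (λ v → P v ∧ E a v)
  inIn  a = size (λ v → P v ∧ E v a)

  ∑P : (Fin n → ℕ) → ℕ
  ∑P f = ∑[ a < n ] (ind (P a) * f a)

  ∑P-mono : ∀ {f g : Fin n → ℕ} → (∀ a → T (P a) → f a ≤ g a) → ∑P f ≤ ∑P g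
  ∑P-mono f≤g = sum-mono (λ a → weighted (P a) (f≤g a))
    where
    weighted : ∀ b {m k} → (T b → m ≤ k) → ind b * m ≤ ind b * k
    weighted true  m≤k = *-monoʳ-≤ 1 (m≤k tt)
    weighted false _   = z≤n

  ∑P-+ : ∀ (f g : Fin n → ℕ) → ∑P (λ a → f a + g a) ≡ ∑P f + ∑P g
  ∑P-+ f g = trans (sum-cong-≗ (λ a → *-distribˡ-+ (ind (P a)) (f a) (g a)))
                   (∑-distrib-+ (λ a → ind (P a) * f a) (λ a → ind (P a) * g a))

  ∑P-const : ∀ c → ∑P (λ _ → c) ≡ c * d
  ∑P-const c = trans (sum-cong-≗ (λ a → *-comm (ind (P a)) c)) (sym (*-distribˡ-sum c (ind ∘ P)))

  -- For a ∈ P, the out-neighbours of a in P, its in-neighbours in P and a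
  -- itself are pairwise disjoint subsets of P: E has no loops and no 2-cycles.
  degrees-in-P : ∀ a → T (P a) → outIn a + inIn a + 1 ≤ d
  degrees-in-P a Pa = begin
    outIn a + inIn a + 1                    ≤⟨ +-monoʳ-≤ (outIn a + inIn a) a-counted ⟩
    outIn a + inIn a + size (λ v → ⌊ a ≟ v ⌋)
      ≡⟨ cong (_+ size (λ v → ⌊ a ≟ v ⌋)) (∑-distrib-+ (λ v → ind (P v ∧ E a v)) (λ v → ind (P v ∧ E v a))) ⟨
    _                                       ≡⟨ ∑-distrib-+ _ (λ v → ind ⌊ a ≟ v ⌋) ⟨
    ∑[ v < n ] (ind (P v ∧ E a v) + ind (P v ∧ E v a) + ind ⌊ a ≟ v ⌋)
                                            ≤⟨ sum-mono parts ⟩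
    d                                       ∎
    where
    open ≤-Reasoning
    a-counted : 1 ≤ size (λ v → ⌊ a ≟ v ⌋)
    a-counted with a ≟ a in eq
    ... | yes _ = ≤-trans (≤-reflexive (cong (ind ∘ ⌊_⌋) (sym eq))) (summand≤sum (λ v → ind ⌊ a ≟ v ⌋) a)
    ... | no a≢a = ⊥-elim (a≢a refl)
    self : ∀ p e → T p → ¬ T e → ind (p ∧ e) + ind (p ∧ e) + 1 ≤ ind p
    self true false _ _  = ≤-refl
    self true true  _ ¬e = ⊥-elim (¬e tt)
    distinct : ∀ p e e′ → (T e → ¬ T e′) → ind (p ∧ e) + ind (p ∧ e′) ≤ ind p
    distinct false _     _     _ = z≤n
    distinct true  false false _ = z≤n
    distinct true  false true  _ = ≤-refl
    distinct true  true  false _ = ≤-refl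
    distinct true  true  true  h = ⊥-elim (h tt tt)
    parts : ∀ v → ind (P v ∧ E a v) + ind (P v ∧ E v a) + ind ⌊ a ≟ v ⌋ ≤ ind (P v)
    parts v with a ≟ v
    ... | yes refl = self (P a) (E a a) Pa (irrefl a)
    ... | no _     = subst (_≤ ind (P v)) (sym (+-identityʳ _)) (distinct (P v) (E a v) (E v a) (asym a v))

  -- Double counting: summing in-degrees or out-degrees over P both count the
  -- arcs inside P.
  arcs-double-count : ∑P inIn ≡ ∑P outIn
  arcs-double-count = begin
    ∑[ a < n ] (ind (P a) * ∑[ v < n ] ind (P v ∧ E v a))   ≡⟨ sum-cong-≗ (λ a → *-distribˡ-sum (ind (P a)) (λ v → ind (P v ∧ E v a))) ⟩
    ∑[ a < n ] ∑[ v < n ] (ind (P a) * ind (P v ∧ E v a))  ≡⟨ sum-cong-≗ (λ a → sum-cong-≗ (λ v → swap (P a) (P v) (E v a))) ⟩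
    ∑[ a < n ] ∑[ v < n ] (ind (P v) * ind (P a ∧ E v a))  ≡⟨ ∑-comm (λ a v → ind (P v) * ind (P a ∧ E v a)) ⟩
    ∑[ v < n ] ∑[ a < n ] (ind (P v) * ind (P a ∧ E v a))  ≡⟨ sum-cong-≗ (λ v → *-distribˡ-sum (ind (P v)) (λ a → ind (P a ∧ E v a))) ⟨
    ∑[ v < n ] (ind (P v) * ∑[ a < n ] ind (P a ∧ E v a))   ∎
    where
    open ≡-Reasoning
    swap : ∀ p q e → ind p * ind (q ∧ e) ≡ ind q * ind (p ∧ e)
    swap false false _ = refl
    swap false true  _ = refl
    swap true  false _ = refl
    swap true  true  _ = refl

  -- Hence twice the number of arcs inside P is at most d(d-1).
  arcs-bound : ∑P outIn + ∑P outIn + d ≤ d * d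
  arcs-bound = begin
    ∑P outIn + ∑P outIn + d                 ≡⟨ cong₂ (λ s t → ∑P outIn + s + t) arcs-double-count (trans (∑P-const 1) (*-identityˡ d)) ⟨
    ∑P outIn + ∑P inIn + ∑P (λ _ → 1)       ≡⟨ cong (_+ ∑P (λ _ → 1)) (∑P-+ outIn inIn) ⟨
    _                                       ≡⟨ ∑P-+ (λ a → outIn a + inIn a) (λ _ → 1) ⟨
    ∑P (λ a → outIn a + inIn a + 1)         ≤⟨ ∑P-mono degrees-in-P ⟩
    ∑P (λ _ → d)                            ≡⟨ ∑P-const d ⟩
    d * d                                   ∎
    where open ≤-Reasoning

  -- A nonempty P contains a vertex with fewer than d/2 out-neighbours in P:
  -- otherwise the arcs inside P would number at least d²/2.
  low-outdegree : 1 ≤ d → ∃[ a ] T (P a) × 2 * outIn a < d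
  low-outdegree d≥1 with any? (λ a → T? (P a) ×-dec (2 * outIn a <? d))
  ... | yes found = found
  ... | no none   = ⊥-elim (<⇒≱ d≥1 d≤0)
    where
    open ≤-Reasoning
    many : ∀ a → T (P a) → d ≤ outIn a + outIn a
    many a Pa = ≤-trans (≮⇒≥ (λ few → none (a , Pa , few)))
                        (≤-reflexive (cong (outIn a +_) (+-identityʳ (outIn a))))
    d≤0 : d ≤ 0
    d≤0 = +-cancelˡ-≤ (∑P outIn + ∑P outIn) d 0 (begin
      ∑P outIn + ∑P outIn + d                ≤⟨ arcs-bound ⟩
      d * d                                  ≡⟨ ∑P-const d ⟨
      ∑P (λ _ → d)                           ≤⟨ ∑P-mono many ⟩
      ∑P (λ a → outIn a + outIn a)           ≡⟨ ∑P-+ outIn outIn ⟩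
      ∑P outIn + ∑P outIn                    ≡⟨ +-identityʳ _ ⟨
      ∑P outIn + ∑P outIn + 0                ∎)

two-step? : ∀ {n} (E : Digraph n) x v → Dec (∃[ a ] T (E x a ∧ E a v))
two-step? E x v = any? (λ a → T? (E x a ∧ E a v))

N² : ∀ {n} → Digraph n → Fin n → Fin n → Bool
N² E x v = E x v ∨ ⌊ two-step? E x v ⌋

N²-one : ∀ {n} {E : Digraph n} {x v} → T (E x v) → T (N² E x v)
N²-one {E = E} {x} {v} x→v = from (T-∨ {E x v} {⌊ two-step? E x v ⌋}) (inj₁ x→v)

N²-two : ∀ {n} {E : Digraph n} {x a v} → T (E x a) → T (E a v) → T (N² E x v)
N²-two {E = E} {x} {a} {v} x→a a→v = from (T-∨ {E x v} {⌊ two-step? E x v ⌋})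
  (inj₂ (fromWitness {a? = two-step? E x v} (a , from (T-∧ {E x a}) (x→a , a→v))))

nonempty : ∀ {n d} → Fin n → 3 * n ≤ 8 * d → 1 ≤ d
nonempty {suc n} {zero}  _ ()
nonempty {_}     {suc d} _ _ = s≤s z≤n

-- The counting behind the bound on |N²(x)|, with d = |N⁺(x)|, o = |N⁺(a)|,
-- t = |N⁺(x) ∩ N⁺(a)| and c = |N²(x)|:  16c ≥ 16(d + o - t) ≥ 8d + 8 + 16o.
second-neighbourhood-arith : ∀ n d o c t → d + o ≤ c + t → 2 * t < d →
  3 * n ≤ 8 * d → 3 * n ≤ 8 * o → 9 * n + 8 ≤ 16 * c
second-neighbourhood-arith n d o c t covered few dn on = +-cancelʳ-≤ (16 * t) (9 * n + 8) (16 * c) (begin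
  9 * n + 8 + 16 * t                        ≡⟨ regroup n t ⟩
  3 * n + 2 * (3 * n) + 8 * suc (2 * t)     ≤⟨ +-mono-≤ (+-mono-≤ dn (*-monoʳ-≤ 2 on)) (*-monoʳ-≤ 8 few) ⟩
  8 * d + 2 * (8 * o) + 8 * d               ≡⟨ collect d o ⟩
  16 * (d + o)                              ≤⟨ *-monoʳ-≤ 16 covered ⟩
  16 * (c + t)                              ≡⟨ *-distribˡ-+ 16 c t ⟩
  16 * c + 16 * t                           ∎)
  where
  open ≤-Reasoning
  regroup : ∀ n t → 9 * n + 8 + 16 * t ≡ 3 * n + 2 * (3 * n) + 8 * suc (2 * t)
  regroup = solve-∀
  collect : ∀ d o → 8 * d + 2 * (8 * o) + 8 * d ≡ 16 * (d + o)
  collect = solve-∀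

N²-large : ∀ {n} (E : Digraph n) → IsOriented E → (∀ v → 3 * n ≤ 8 * outdeg E v) →
  ∀ x → 9 * n + 8 ≤ 16 * size (N² E x)
N²-large {n} E ori out x = bound (low-outdegree (nonempty x (out′ x)))
  where
  open InducedSubgraph E ori (E x)
  out′ : ∀ v → 3 * n ≤ 8 * size (E v)
  out′ v = subst (λ k → 3 * n ≤ 8 * k) (outdeg≡size E v) (out v)
  bound : ∃[ a ] T (E x a) × 2 * outIn a < size (E x) → 9 * n + 8 ≤ 16 * size (N² E x)
  bound (a , x→a , few) = second-neighbourhood-arith n _ _ _ (outIn a)
      (size-union (E x) (E a) (N² E x) covered) few (out′ x) (out′ a)
    where
    covered : ∀ v → T (E x v) ⊎ T (E a v) → T (N² E x v)
    covered v (inj₁ x→v) = N²-one {E = E} x→v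
    covered v (inj₂ a→v) = N²-two {E = E} x→a a→v

overlap-arith : ∀ n a b s → 9 * n + 8 ≤ 16 * a → 9 * n + 8 ≤ 16 * b → a + b ≤ n + s → 1 ≤ s
overlap-arith n a b (suc s) _  _  _       = s≤s z≤n
overlap-arith n a b zero    ha hb a+b≤n = contradiction (m+n≤o⇒n≤o (2 * n) 2n+16≤0) λ ()
  where
  open ≤-Reasoning
  regroup : ∀ n → 16 * n + (2 * n + 16) ≡ (9 * n + 8) + (9 * n + 8)
  regroup = solve-∀
  2n+16≤0 : 2 * n + 16 ≤ 0
  2n+16≤0 = +-cancelˡ-≤ (16 * n) (2 * n + 16) 0 (begin
    16 * n + (2 * n + 16)            ≡⟨ regroup n ⟩
    (9 * n + 8) + (9 * n + 8)        ≤⟨ +-mono-≤ ha hb ⟩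
    16 * a + 16 * b                  ≡⟨ *-distribˡ-+ 16 a b ⟨
    16 * (a + b)                     ≤⟨ *-monoʳ-≤ 16 a+b≤n ⟩
    16 * (n + 0)                     ≡⟨ *-distribˡ-+ 16 n 0 ⟩
    16 * n + 0                       ∎)

-- Pigeonhole: |P| + |Q| > n forces a common vertex.
large-sets-meet : ∀ {n} (P Q : Fin n → Bool) →
  9 * n + 8 ≤ 16 * size P → 9 * n + 8 ≤ 16 * size Q → ∃[ v ] T (P v) × T (Q v)
large-sets-meet {n} P Q hP hQ =
  map₂ (to T-∧) (size-witness (λ v → P v ∧ Q v) (overlap-arith n (size P) (size Q) _ hP hQ P+Q≤n+P∩Q))
  where
  P+Q≤n+P∩Q : size P + size Q ≤ n + size (λ v → P v ∧ Q v)
  P+Q≤n+P∩Q = subst (λ m → size P + size Q ≤ m + size (λ v → P v ∧ Q v)) (size-all n)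
                (size-union P Q (λ _ → true) (λ _ _ → tt))

data Walk {n} (E : Digraph n) : ℕ → Fin n → Fin n → Set where
  ε   : ∀ {x} → Walk E 0 x x
  _◅_ : ∀ {k x z y} → T (E x z) → Walk E k z y → Walk E (suc k) x y

infixr 5 _◅_ _◅◅_

_◅◅_ : ∀ {n} {E : Digraph n} {k m x z y} → Walk E k x z → Walk E m z y → Walk E (k + m) x y
ε         ◅◅ w = w
(e ◅ w₁)  ◅◅ w = e ◅ (w₁ ◅◅ w)

reverse : ∀ {n} {E : Digraph n} {k x y} → Walk (flip E) k x y → Walk E k y x
reverse ε = ε
reverse {E = E} {suc k} {x} {y} (e ◅ w) =
  subst (λ m → Walk E m y x) (+-comm k 1) (reverse w ◅◅ (e ◅ ε))

N²-walk : ∀ {n} (E : Digraph n) {x v} → T (N² E x v) → ∃[ k ] k ≤ 2 × Walk E k x v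
N²-walk E {x} {v} x⇝v with to (T-∨ {E x v} {⌊ two-step? E x v ⌋}) x⇝v
... | inj₁ x→v = 1 , s≤s z≤n , x→v ◅ ε
... | inj₂ x⇝⇝v with toWitness x⇝⇝v
...   | a , x→a→v with to (T-∧ {E x a}) x→a→v
...     | x→a , a→v = 2 , ≤-refl , x→a ◅ a→v ◅ ε

-- Route E x y vs: the list x ∷ vs consists of the vertices of a walk from x to y.
data Route {n} (E : Digraph n) : Fin n → Fin n → List (Fin n) → Set where
  stay : ∀ {x} → Route E x x []
  step : ∀ {x z y vs} → T (E x z) → Route E z y vs → Route E x y (z ∷ vs)

module _ {n} {E : Digraph n} where

  route→path : ∀ {x y vs} → Route E x y vs → Unique (x ∷ vs) → DirPath E x y
  route→path {x} {y} {vs} r u = path (x ∷ vs) (chain r) u refl (ends r)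
    where
    chain : ∀ {x y vs} → Route E x y vs → Chain E (x ∷ vs)
    chain {x} stay     = [ x ]
    chain (step e r)   = e ∷ chain r
    ends : ∀ {x y vs} → Route E x y vs → last (x ∷ vs) ≡ just y
    ends stay       = refl
    ends (step _ r) = ends r

  shortcut : ∀ {x z y vs} → Route E z y vs → x ∈ z ∷ vs →
    ∃[ ws ] Route E x y ws × length ws ≤ length vs × (Unique (z ∷ vs) → Unique (x ∷ ws))
  shortcut r          (here refl) = _ , r , ≤-refl , id
  shortcut (step _ r) (there x∈)  with shortcut r x∈
  ... | ws , r′ , shorter , unique = ws , r′ , m≤n⇒m≤1+n shorter , λ { (_ ∷ u) → unique u }

  SimpleRoute : ℕ → Fin n → Fin n → Set
  SimpleRoute k x y = ∃[ vs ] Route E x y vs × Unique (x ∷ vs) × length vs ≤ k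

  -- Prepending an arc x → z: if x already lies on the route, cut the loop.
  prepend : ∀ {k x z y} → T (E x z) → SimpleRoute k z y → SimpleRoute (suc k) x y
  prepend {x = x} {z} e (vs , r , u , short) with Any.any? (x ≟_) (z ∷ vs)
  ... | no x∉  = z ∷ vs , step e r , ¬Any⇒All¬ _ x∉ ∷ u , s≤s short
  ... | yes x∈ with shortcut r x∈
  ...   | ws , r′ , shorter , unique = ws , r′ , unique u , ≤-trans shorter (m≤n⇒m≤1+n short)

  erase : ∀ {k x y} → Walk E k x y → SimpleRoute k x y
  erase ε       = [] , stay , [] ∷ [] , z≤n
  erase (e ◅ w) = prepend e (erase w)

  walk→path : ∀ {k x y} → Walk E k x y → Σ (DirPath E x y) (λ p → pathLength p ≤ k)
  walk→path w with erase w
  ... | vs , r , u , short = route→path r u , short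

flip-oriented : ∀ {n} {E : Digraph n} → IsOriented E → IsOriented (flip E)
flip-oriented ori = record { irrefl = irrefl ; asym = λ u v → asym v u }
  where open IsOriented ori

-- In-degrees of E are out-degrees of the reversed graph, so N²(flip E) y is
-- large too; a common vertex v of N²(E) x and N²(flip E) y gives walks
-- x ⇝ v ⇝ y of length ≤ 2 + 2, and loop erasure turns them into a path.
fact2p21 : (n : ℕ) (E : Digraph n) → IsOriented E →
    (∀ v → 3 * n ≤ 8 * indeg E v) → (∀ v → 3 * n ≤ 8 * outdeg E v) →
    ∀ x y → Σ (DirPath E x y) (λ p → pathLength p ≤ 4)
fact2p21 n E ori in≥ out≥ x y =
  connect (large-sets-meet (N² E x) (N² (flip E) y)
            (N²-large E ori out≥ x) (N²-large (flip E) (flip-oriented ori) in≥ y))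
  where
  connect : ∃[ v ] T (N² E x v) × T (N² (flip E) y v) → Σ (DirPath E x y) (λ p → pathLength p ≤ 4)
  connect (v , x⇝v , y⇜v) = join (N²-walk E x⇝v) (N²-walk (flip E) y⇜v)
    where
    join : ∃[ k ] k ≤ 2 × Walk E k x v → ∃[ m ] m ≤ 2 × Walk (flip E) m y v →
           Σ (DirPath E x y) (λ p → pathLength p ≤ 4)
    join (k , k≤2 , w₁) (m , m≤2 , w₂) =
      map₂ (λ |p|≤k+m → ≤-trans |p|≤k+m (+-mono-≤ k≤2 m≤2)) (walk→path (w₁ ◅◅ reverse w₂))
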